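{- Let $G$ be a finite simple connected graph which is not a star, $\mathcal S\in F_{sa}(G^*)$ and $\mathcal P=\mathrm{EGP}(\mathcal S)$. If $|U(\mathcal S)|\le\gamma'$, then $|\mathcal P_{\mathrm i}|\le|V_{\mathrm i}|$.
   Context: A set representation of a graph $H$ is a family $\mathcal S=(S_x)_{x\in V(H)}$ of nonempty sets with $xy\in E(H)$ iff $S_x\cap S_y\neq\emptyset$ for distinct $x,y$; universe $U(\mathcal S)$; simple if $|S_x\cap S_y|\le1$, antichain if $S_x\not\subseteq S_y$ for distinct $x,y$. $F_{sa}(H)$ is the set of simple antichain representations with minimum $|U(\mathcal S)|$. $G^*$ is the line graph of $G$. For $U(\mathcal S)=\{s_1,\dots,s_p\}$, $\mathrm{EGP}(\mathcal S)=(Q_1,\dots,Q_p)$ with $Q_j=\{e\in E(G):s_j\in S_e\}$ (cliques of $G^*$, possibly single vertices). A clique $C$ of $G^*$ is induced by a $v$-star if all edges in $C$ are incident with $v$. A star is $K_{1,n}$. A plume is a vertex of degree 1; a vertex of degree $\ge2$ is critical if adjacent to a plume, inland otherwise; $V_{\mathrm c}=\{v_1,\dots,v_k\}$, $V_{\mathrm i}$ are the critical and inland vertices, $m_i$ the number of plumes adjacent to $v_i$, and $\gamma'=|V_{\mathrm i}|+\sum_{i=1}^k(m_i+1)$. $\mathcal P_{\mathrm c}$ is the set of cliques of $\mathcal P$ induced by a $v$-star with $v\in V_{\mathrm c}$, and $\mathcal P_{\mathrm i}=\mathcal P\setminus\mathcal P_{\mathrm c}$. -}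

module Defs where

open import Data.Nat using (ℕ; zero; suc; _+_; _≤_; _≤ᵇ_; _≡ᵇ_)
open import Data.Bool using (Bool; true; false; _∧_; _∨_; not; if_then_else_)
open import Data.Fin using (Fin; zero; suc; _≟_)
open import Data.Fin.Subset using (Subset; _∈_; _∩_; _⊆_; Nonempty; ∣_∣)
open import Data.Fin.Subset.Properties using (_∈?_)
open import Data.Product using (Σ; ∃; _×_; _,_)
open import Data.Sum using (_⊎_)
open import Relation.Nullary using (¬_)
open import Relation.Nullary.Decidable using (⌊_⌋)
open import Relation.Binary.PropositionalEquality using (_≡_; _≢_)
open import Relation.Binary.Construct.Closure.ReflexiveTransitive using (Star)
open import Function.Bundles using (_⇔_)

anyF : ∀ {k} → (Fin k → Bool) → Bool
anyF {zero}  f = false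
anyF {suc k} f = f zero ∨ anyF (λ i → f (suc i))

allF : ∀ {k} → (Fin k → Bool) → Bool
allF {zero}  f = true
allF {suc k} f = f zero ∧ allF (λ i → f (suc i))

sumF : ∀ {k} → (Fin k → ℕ) → ℕ
sumF {zero}  f = 0
sumF {suc k} f = f zero + sumF (λ i → f (suc i))

countF : ∀ {k} → (Fin k → Bool) → ℕ
countF f = sumF (λ i → if f i then 1 else 0)

record Graph : Set where
  field
    n m      : ℕ
    src tgt  : Fin m → Fin n
    loopless : ∀ e → src e ≢ tgt e
    noMulti  : ∀ e f →
               ((src e ≡ src f × tgt e ≡ tgt f) ⊎ (src e ≡ tgt f × tgt e ≡ src f)) →
               e ≡ f

module _ (G : Graph) where
  open Graph G

  Incident : Fin m → Fin n → Set
  Incident e v = src e ≡ v ⊎ tgt e ≡ v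

  Adj : Fin n → Fin n → Set
  Adj u v = ∃ λ e → (src e ≡ u × tgt e ≡ v) ⊎ (src e ≡ v × tgt e ≡ u)

  Connected : Set
  Connected = ∀ u v → Star Adj u v

  IsStar : Set
  IsStar = Σ (Fin n) λ c → (∀ w → w ≢ c → Adj c w) × (∀ e → Incident e c)

  -- adjacency in the line graph G* (vertex set = E(G) = Fin m)
  LineAdj : Fin m → Fin m → Set
  LineAdj e f = ∃ λ v → Incident e v × Incident f v

  incB : Fin m → Fin n → Bool
  incB e v = ⌊ src e ≟ v ⌋ ∨ ⌊ tgt e ≟ v ⌋

  adjB : Fin n → Fin n → Bool
  adjB u v = anyF λ e → (⌊ src e ≟ u ⌋ ∧ ⌊ tgt e ≟ v ⌋) ∨ (⌊ src e ≟ v ⌋ ∧ ⌊ tgt e ≟ u ⌋)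

  deg : Fin n → ℕ
  deg v = countF (λ e → incB e v)

  isPlume : Fin n → Bool
  isPlume x = deg x ≡ᵇ 1

  hasPlume : Fin n → Bool
  hasPlume v = anyF λ x → isPlume x ∧ adjB v x

  isCritical : Fin n → Bool
  isCritical v = (2 ≤ᵇ deg v) ∧ hasPlume v

  isInland : Fin n → Bool
  isInland v = (2 ≤ᵇ deg v) ∧ not (hasPlume v)

  plumesAt : Fin n → ℕ
  plumesAt v = countF λ x → isPlume x ∧ adjB v x

  numInland : ℕ
  numInland = countF isInland

  gamma' : ℕ
  gamma' = numInland + sumF (λ v → if isCritical v then suc (plumesAt v) else 0)

-- The family is S : Fin k → Subset p; the universe U(S) is the union of
-- the S x, which is required to be all of Fin p, so |U(S)| = p.

record SetRep {k : ℕ} (R : Fin k → Fin k → Set) (p : ℕ) (S : Fin k → Subset p) : Set where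
  field
    nonempty : ∀ x → Nonempty (S x)
    represents : ∀ x y → x ≢ y → (R x y ⇔ Nonempty (S x ∩ S y))
    universe : ∀ s → ∃ λ x → s ∈ S x

record SimpleAntichainRep {k : ℕ} (R : Fin k → Fin k → Set) (p : ℕ) (S : Fin k → Subset p) : Set where
  field
    rep       : SetRep R p S
    simple    : ∀ x y → x ≢ y → ∣ S x ∩ S y ∣ ≤ 1
    antichain : ∀ x y → x ≢ y → ¬ (S x ⊆ S y)

InFsa : {k : ℕ} (R : Fin k → Fin k → Set) (p : ℕ) (S : Fin k → Subset p) → Set
InFsa {k} R p S = SimpleAntichainRep R p S ×
  (∀ (p' : ℕ) (S' : Fin k → Subset p') → SimpleAntichainRep R p' S' → p ≤ p')

module _ (G : Graph) where
  open Graph G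

  -- EGP(S) = (Q_1,…,Q_p) with Q_j = {e : s_j ∈ S_e}.  Q_j ∈ P_c iff Q_j is
  -- induced by a v-star for some critical v, i.e. every e ∈ Q_j is incident
  -- with v.
  inPc : {p : ℕ} → (Fin m → Subset p) → Fin p → Bool
  inPc S j = anyF λ v → isCritical G v ∧ allF (λ e → not ⌊ j ∈? S e ⌋ ∨ incB G e v)

  numPi : {p : ℕ} → (Fin m → Subset p) → ℕ
  numPi S = countF λ j → not (inPc S j)

-- Since p = |P_c| + |P_i| and γ' = |V_i| + Σ_{v ∈ V_c} (m_v + 1), it suffices to find, for
-- every critical vertex v, m_v + 1 indices j with Q_j induced by a v-star, disjointly in v.
-- Take the points j lying on a plume edge at v. Every edge whose set contains j meets that
-- plume edge in G*, and the plume has degree 1, so the edge is incident with v. In particular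
-- a plume edge at another critical vertex w carrying j would join v and w, which is impossible
-- as plumes are not critical; so these point sets are disjoint. As G is connected and not a
-- star, v has a non-plume neighbour w. The m_v plume edges at v and the edge vw are pairwise
-- adjacent in G*, so their sets, cut down to the points above, are distinct (antichain) and
-- pairwise meet in exactly one point (simplicity); by the de Bruijn–Erdős theorem there are
-- at least m_v + 1 such points.

module Submission where

open import Defs
open import Algebra.Bundles using (CommutativeMonoid)
open import Data.Bool using (Bool; true; false; _∧_; _∨_; not; if_then_else_)
open import Data.Bool.Properties using (∧-zeroʳ; ∧-identityʳ; ∨-identityʳ; T-≡)
open import Data.Empty using (⊥; ⊥-elim)
open import Data.Fin using (Fin; zero; suc; _≟_)
open import Data.Fin.Properties using (suc-injective)
open import Data.Fin.Subset using (Subset; _∩_; _⊆_; Nonempty; ∣_∣; inside; outside)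
open import Data.Fin.Subset.Properties using (_∈?_; x∈p∩q⁺; x∈p∩q⁻)
import Data.Integer as ℤ
import Data.Integer.Properties as ℤ
import Data.Integer.Solver
open import Data.Nat using (ℕ; zero; suc; _+_; _*_; _≤_; _<_; z≤n; s≤s; _≤?_)
open import Data.Nat.Properties as ℕ using (≤-trans; ≤-reflexive; +-mono-≤; m≤n+m; +-comm; +-suc)
open import Data.Product using (∃; _×_; _,_; proj₁; proj₂)
open import Data.Rational.Unnormalised as ℚ using (ℚᵘ; mkℚᵘ; *≡*; *≤*; *<*; 0ℚᵘ; 1ℚᵘ)
import Data.Rational.Unnormalised.Properties as ℚ
open import Data.Sum using (_⊎_; inj₁; inj₂)
open import Data.Vec using ([]; _∷_)
open import Function using (_∘_; case_of_)
open import Function.Bundles using (Equivalence)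
open import Relation.Nullary using (¬_; Dec; yes; no)
open import Relation.Nullary.Decidable using (⌊_⌋; ⌊⌋-map′)
open import Relation.Binary.PropositionalEquality
open import Relation.Binary.Construct.Closure.ReflexiveTransitive using (Star; ε; _◅_)

open import Algebra.Properties.CommutativeSemigroup ℕ.+-commutativeSemigroup
  using () renaming (interchange to +-interchange)
open import Algebra.Properties.CommutativeMonoid.Sum ℚ.+-0-commutativeMonoid
  using (sum; ∑-comm; sum-cong-≋)
open import Algebra.Definitions.RawMonoid (CommutativeMonoid.rawMonoid ℚ.+-0-commutativeMonoid)
  using () renaming (_×_ to _⊛_)

∧-true⁻ : ∀ {a b} → a ∧ b ≡ true → a ≡ true × b ≡ true
∧-true⁻ {true} {true} _ = refl , refl

∧-true⁺ : ∀ {a b} → a ≡ true → b ≡ true → a ∧ b ≡ true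
∧-true⁺ refl refl = refl

∨-true⁻ : ∀ {a b} → a ∨ b ≡ true → a ≡ true ⊎ b ≡ true
∨-true⁻ {true}  _ = inj₁ refl
∨-true⁻ {false} e = inj₂ e

∨-true⁺ˡ : ∀ {a} b → a ≡ true → a ∨ b ≡ true
∨-true⁺ˡ _ refl = refl

∨-true⁺ʳ : ∀ a {b} → b ≡ true → a ∨ b ≡ true
∨-true⁺ʳ true  _ = refl
∨-true⁺ʳ false e = e

not-true⁻ : ∀ {a} → not a ≡ true → a ≡ false
not-true⁻ {false} _ = refl

not-true⁺ : ∀ {a} → a ≡ false → not a ≡ true
not-true⁺ refl = refl

true≢false : ∀ {a} → a ≡ true → a ≢ false
true≢false refl ()

true-or-false : ∀ a → a ≡ true ⊎ a ≡ false
true-or-false true  = inj₁ refl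
true-or-false false = inj₂ refl

∧-restrict : ∀ a b c → (a ∧ b ≡ true → c ≡ true) → (a ∧ c) ∧ (b ∧ c) ≡ a ∧ b
∧-restrict true  true  c h rewrite h refl = refl
∧-restrict true  false c _ = ∧-zeroʳ c
∧-restrict false _     _ _ = refl

implication-false⁻ : ∀ a b → not a ∨ b ≡ false → a ≡ true × b ≡ false
implication-false⁻ true false _ = refl , refl

⌊⌋-true⁻ : ∀ {P : Set} (d : Dec P) → ⌊ d ⌋ ≡ true → P
⌊⌋-true⁻ (yes p) _ = p

⌊⌋-true⁺ : ∀ {P : Set} (d : Dec P) → P → ⌊ d ⌋ ≡ true
⌊⌋-true⁺ (yes _) _ = refl
⌊⌋-true⁺ (no ¬p) p = ⊥-elim (¬p p)

⌊⌋-false⁺ : ∀ {P : Set} (d : Dec P) → ¬ P → ⌊ d ⌋ ≡ false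
⌊⌋-false⁺ (yes p) ¬p = ⊥-elim (¬p p)
⌊⌋-false⁺ (no _)  _  = refl

≟-true⁻ : ∀ {k} {i j : Fin k} → ⌊ i ≟ j ⌋ ≡ true → i ≡ j
≟-true⁻ {i = i} {j} = ⌊⌋-true⁻ (i ≟ j)

≟-true⁺ : ∀ {k} {i j : Fin k} → i ≡ j → ⌊ i ≟ j ⌋ ≡ true
≟-true⁺ {i = i} {j} = ⌊⌋-true⁺ (i ≟ j)

anyF⁻ : ∀ {k} (f : Fin k → Bool) → anyF f ≡ true → ∃ λ i → f i ≡ true
anyF⁻ {suc k} f e with ∨-true⁻ {f zero} e
... | inj₁ p = zero , p
... | inj₂ p with anyF⁻ (λ i → f (suc i)) p
...   | i , q = suc i , q

anyF⁺ : ∀ {k} (f : Fin k → Bool) i → f i ≡ true → anyF f ≡ true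
anyF⁺ f zero    e = ∨-true⁺ˡ _ e
anyF⁺ f (suc i) e = ∨-true⁺ʳ (f zero) (anyF⁺ (λ i → f (suc i)) i e)

anyF-false⁻ : ∀ {k} (f : Fin k → Bool) → anyF f ≡ false → ∀ i → f i ≡ false
anyF-false⁻ f e i with true-or-false (f i)
... | inj₁ p = ⊥-elim (true≢false (anyF⁺ f i p) e)
... | inj₂ p = p

allF⁺ : ∀ {k} (f : Fin k → Bool) → (∀ i → f i ≡ true) → allF f ≡ true
allF⁺ {zero}  f h = refl
allF⁺ {suc k} f h = ∧-true⁺ (h zero) (allF⁺ (λ i → f (suc i)) (λ i → h (suc i)))

allF⁻ : ∀ {k} (f : Fin k → Bool) → allF f ≡ true → ∀ i → f i ≡ true
allF⁻ {suc k} f e zero    = proj₁ (∧-true⁻ e)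
allF⁻ {suc k} f e (suc i) = allF⁻ (λ i → f (suc i)) (proj₂ (∧-true⁻ {f zero} e)) i

allF-false⁻ : ∀ {k} (f : Fin k → Bool) → allF f ≡ false → ∃ λ i → f i ≡ false
allF-false⁻ {suc k} f e with true-or-false (f zero)
... | inj₂ p = zero , p
... | inj₁ p rewrite p with allF-false⁻ (λ i → f (suc i)) e
...   | i , q = suc i , q

decideAnyF : ∀ {k} (f : Fin k → Bool) → (∃ λ i → f i ≡ true) ⊎ (∀ i → f i ≡ false)
decideAnyF f with true-or-false (anyF f)
... | inj₁ p = inj₁ (anyF⁻ f p)
... | inj₂ p = inj₂ (anyF-false⁻ f p)

choose : ∀ {k} (f : Fin k → Bool) → Fin k → Fin k
choose f d with decideAnyF f
... | inj₁ (i , _) = i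
... | inj₂ _       = d

choose-spec : ∀ {k} (f : Fin k → Bool) d →
              f (choose f d) ≡ true ⊎ ((∀ i → f i ≡ false) × choose f d ≡ d)
choose-spec f d with decideAnyF f
... | inj₁ (_ , e) = inj₁ e
... | inj₂ h       = inj₂ (h , refl)

sumF-cong : ∀ {k} {f g : Fin k → ℕ} → (∀ i → f i ≡ g i) → sumF f ≡ sumF g
sumF-cong {zero}  h = refl
sumF-cong {suc k} h = cong₂ _+_ (h zero) (sumF-cong (λ i → h (suc i)))

sumF-mono-≤ : ∀ {k} {f g : Fin k → ℕ} → (∀ i → f i ≤ g i) → sumF f ≤ sumF g
sumF-mono-≤ {zero}  h = z≤n
sumF-mono-≤ {suc k} h = +-mono-≤ (h zero) (sumF-mono-≤ (λ i → h (suc i)))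

sumF-zero : ∀ {k} → sumF {k} (λ _ → 0) ≡ 0
sumF-zero {zero}  = refl
sumF-zero {suc k} = sumF-zero {k}

sumF-+ : ∀ {k} (f g : Fin k → ℕ) → sumF (λ i → f i + g i) ≡ sumF f + sumF g
sumF-+ {zero}  f g = refl
sumF-+ {suc k} f g = begin
  (f zero + g zero) + sumF (λ i → f (suc i) + g (suc i))
    ≡⟨ cong ((f zero + g zero) +_) (sumF-+ (λ i → f (suc i)) (λ i → g (suc i))) ⟩
  (f zero + g zero) + (sumF (λ i → f (suc i)) + sumF (λ i → g (suc i)))
    ≡⟨ +-interchange (f zero) (g zero) _ _ ⟩
  (f zero + sumF (λ i → f (suc i))) + (g zero + sumF (λ i → g (suc i))) ∎
  where open ≡-Reasoning

sumF-comm : ∀ {k l} (g : Fin k → Fin l → ℕ) →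
            sumF (λ i → sumF (g i)) ≡ sumF (λ x → sumF (λ i → g i x))
sumF-comm {zero}  {l} g = sym (sumF-zero {l})
sumF-comm {suc k}     g = trans (cong (sumF (g zero) +_) (sumF-comm (λ i → g (suc i))))
                                (sym (sumF-+ (g zero) (λ x → sumF (λ i → g (suc i) x))))

𝟙 : Bool → ℕ
𝟙 b = if b then 1 else 0

countF-cong : ∀ {k} {f g : Fin k → Bool} → (∀ i → f i ≡ g i) → countF f ≡ countF g
countF-cong h = sumF-cong (λ i → cong 𝟙 (h i))

countF-mono : ∀ {k} {f g : Fin k → Bool} → (∀ i → f i ≡ true → g i ≡ true) →
              countF f ≤ countF g
countF-mono {zero}          h = z≤n
countF-mono {suc k} {f} {g} h with true-or-false (f zero)
... | inj₁ p rewrite p | h zero p = s≤s (countF-mono (λ i → h (suc i)))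
... | inj₂ p rewrite p = ≤-trans (countF-mono (λ i → h (suc i))) (m≤n+m _ (𝟙 (g zero)))

countF-false : ∀ {k} (f : Fin k → Bool) → (∀ i → f i ≡ false) → countF f ≡ 0
countF-false {zero}  f h = refl
countF-false {suc k} f h rewrite h zero = countF-false (λ i → f (suc i)) (λ i → h (suc i))

countF-pos⁻ : ∀ {k} (f : Fin k → Bool) → 1 ≤ countF f → ∃ λ i → f i ≡ true
countF-pos⁻ {suc k} f le with true-or-false (f zero)
... | inj₁ p = zero , p
... | inj₂ p rewrite p with countF-pos⁻ (λ i → f (suc i)) le
...   | i , q = suc i , q

countF-split : ∀ {k} (g h : Fin k → Bool) →
               countF (λ x → g x ∧ h x) + countF (λ x → g x ∧ not (h x)) ≡ countF g
countF-split {zero}  g h = refl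
countF-split {suc k} g h with g zero | h zero
... | false | _     = countF-split (λ x → g (suc x)) (λ x → h (suc x))
... | true  | true  = cong suc (countF-split (λ x → g (suc x)) (λ x → h (suc x)))
... | true  | false = trans (+-suc _ _) (cong suc (countF-split (λ x → g (suc x)) (λ x → h (suc x))))

countF-complement : ∀ {k} (f : Fin k → Bool) → countF f + countF (λ i → not (f i)) ≡ k
countF-complement {zero}  f = refl
countF-complement {suc k} f with f zero
... | true  = cong suc (countF-complement (λ i → f (suc i)))
... | false = trans (+-suc _ _) (cong suc (countF-complement (λ i → f (suc i))))

countF-at : ∀ {k} (f : Fin k → Bool) a → countF (λ i → f i ∧ ⌊ i ≟ a ⌋) ≡ 𝟙 (f a)
countF-at {suc k} f zero =
  trans (cong₂ _+_ (cong 𝟙 (∧-identityʳ (f zero))) (countF-false _ (λ i → ∧-zeroʳ (f (suc i)))))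
        (ℕ.+-identityʳ _)
countF-at {suc k} f (suc a) = cong₂ _+_ (cong 𝟙 (∧-zeroʳ (f zero)))
  (trans (countF-cong (λ i → cong (f (suc i) ∧_) (⌊⌋-map′ _ _ (i ≟ a)))) (countF-at (λ i → f (suc i)) a))

_without_ : ∀ {k} → (Fin k → Bool) → Fin k → Fin k → Bool
(f without a) i = f i ∧ not ⌊ i ≟ a ⌋

countF-remove : ∀ {k} (f : Fin k → Bool) a → countF f ≡ 𝟙 (f a) + countF (f without a)
countF-remove f a = trans (sym (countF-split f (λ i → ⌊ i ≟ a ⌋)))
                          (cong (_+ countF (f without a)) (countF-at f a))

countF-remove-true : ∀ {k} (f : Fin k → Bool) {a} → f a ≡ true → countF f ≡ suc (countF (f without a))
countF-remove-true f {a} fa = trans (countF-remove f a) (cong (λ b → 𝟙 b + countF (f without a)) fa)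

countF-pos⁺ : ∀ {k} (f : Fin k → Bool) a → f a ≡ true → 1 ≤ countF f
countF-pos⁺ f a fa = subst (1 ≤_) (sym (countF-remove-true f fa)) (s≤s z≤n)

countF-two⁺ : ∀ {k} (f : Fin k → Bool) a b → a ≢ b → f a ≡ true → f b ≡ true → 2 ≤ countF f
countF-two⁺ f a b a≢b fa fb = subst (2 ≤_) (sym (countF-remove-true f fa))
  (s≤s (countF-pos⁺ (f without a) b (∧-true⁺ fb (not-true⁺ (⌊⌋-false⁺ (b ≟ a) (a≢b ∘ sym))))))

countF-two⁻ : ∀ {k} (f : Fin k → Bool) → 2 ≤ countF f →
              ∃ λ a → ∃ λ b → a ≢ b × f a ≡ true × f b ≡ true
countF-two⁻ f 2≤ with countF-pos⁻ f (≤-trans (s≤s z≤n) 2≤)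
... | a , fa with countF-pos⁻ (f without a) (ℕ.≤-pred (subst (2 ≤_) (countF-remove-true f fa) 2≤))
...   | b , e with ∧-true⁻ e
...     | fb , b≢a = a , b , (λ a≡b → true≢false (≟-true⁺ (sym a≡b)) (not-true⁻ b≢a)) , fa , fb

countF-injection : ∀ {n k} (P : Fin n → Bool) (Q : Fin k → Bool) (h : ∀ i → P i ≡ true → Fin k) →
                   (∀ i pi → Q (h i pi) ≡ true) →
                   (∀ i j pi pj → h i pi ≡ h j pj → i ≡ j) →
                   countF P ≤ countF Q
countF-injection {zero} P Q h maps inj = z≤n
countF-injection {suc n} P Q h maps inj with true-or-false (P zero)
... | inj₂ p = subst (_≤ countF Q) (cong (λ b → 𝟙 b + countF (λ i → P (suc i))) (sym p))
    (countF-injection (λ i → P (suc i)) Q (λ i → h (suc i)) (λ i → maps (suc i))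
                      (λ i j pi pj → suc-injective ∘ inj (suc i) (suc j) pi pj))
... | inj₁ p = begin
    countF P                             ≡⟨ cong (λ b → 𝟙 b + countF (λ i → P (suc i))) p ⟩
    suc (countF (λ i → P (suc i)))       ≤⟨ s≤s (countF-injection (λ i → P (suc i)) (Q without h zero p)
                                                   (λ i → h (suc i)) maps-rest inj-suc) ⟩
    suc (countF (Q without h zero p))    ≡⟨ sym (countF-remove-true Q (maps zero p)) ⟩
    countF Q                             ∎
  where
  open ℕ.≤-Reasoning
  inj-suc : ∀ i j pi pj → h (suc i) pi ≡ h (suc j) pj → i ≡ j
  inj-suc i j pi pj e = suc-injective (inj (suc i) (suc j) pi pj e)
  maps-rest : ∀ i pi → (Q without h zero p) (h (suc i) pi) ≡ true
  maps-rest i pi = ∧-true⁺ (maps (suc i) pi)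
                            (not-true⁺ (⌊⌋-false⁺ _ (λ e → case inj (suc i) zero pi p e of λ ())))

only-true-at : ∀ {k} (f : Fin k → Bool) a → (∀ i j → f i ≡ true → f j ≡ true → i ≡ j) →
               f a ≡ true → ∀ i → (f without a) i ≡ false
only-true-at f a unique fa i with true-or-false (f i)
... | inj₂ q rewrite q = refl
... | inj₁ q rewrite q | unique i a q fa | ≟-true⁺ {i = a} refl = refl

countF≤𝟙-anyF : ∀ {k} (f : Fin k → Bool) → (∀ i j → f i ≡ true → f j ≡ true → i ≡ j) →
                countF f ≤ 𝟙 (anyF f)
countF≤𝟙-anyF f unique with true-or-false (anyF f)
... | inj₂ p rewrite p | countF-false f (anyF-false⁻ f p) = z≤n
... | inj₁ p with anyF⁻ f p
...   | a , fa rewrite p | countF-remove-true f fa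
                 | countF-false (f without a) (only-true-at f a unique fa) = s≤s z≤n

sumF-countF-disjoint : ∀ {k l} (R : Fin k → Fin l → Bool) →
                       (∀ v w j → R v j ≡ true → R w j ≡ true → v ≡ w) →
                       sumF (λ v → countF (R v)) ≤ countF (λ j → anyF (λ v → R v j))
sumF-countF-disjoint R disjoint = ≤-trans (≤-reflexive (sumF-comm (λ v j → 𝟙 (R v j))))
  (sumF-mono-≤ (λ j → countF≤𝟙-anyF (λ v → R v j) (λ v w → disjoint v w j)))

-- 1/ 0 is the junk value 0.
1/_ : ℕ → ℚᵘ
1/ zero  = 0ℚᵘ
1/ suc d = mkℚᵘ (ℤ.+ 1) d

⊛-1/suc : ∀ m d → (m ⊛ 1/ suc d) ℚ.≃ mkℚᵘ (ℤ.+ m) d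
⊛-1/suc zero    d = *≡* refl
⊛-1/suc (suc m) d = ℚ.≃-trans (ℚ.+-congʳ (1/ suc d) (⊛-1/suc m d)) (*≡* cross)
  where
  open Data.Integer.Solver.+-*-Solver
  cross : ((ℤ.+ 1) ℤ.* (ℤ.+ suc d) ℤ.+ (ℤ.+ m) ℤ.* (ℤ.+ suc d)) ℤ.* (ℤ.+ suc d)
          ≡ (ℤ.+ suc m) ℤ.* (ℤ.+ (suc d * suc d))
  cross = trans (solve 2 (λ x y → (con (ℤ.+ 1) :* y :+ x :* y) :* y := (con (ℤ.+ 1) :+ x) :* (y :* y))
                   refl (ℤ.+ m) (ℤ.+ suc d))
                (cong ((ℤ.+ suc m) ℤ.*_) (sym (ℤ.pos-* (suc d) (suc d))))

⊛-1/-cancelʳ : ∀ n b → 1 ≤ n → 1 ≤ b → (n ⊛ 1/ (b * n)) ℚ.≃ 1/ b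
⊛-1/-cancelʳ (suc n) (suc b) _ _ = ℚ.≃-trans (⊛-1/suc (suc n) (n + b * suc n)) (*≡* cross)
  where
  cross : (ℤ.+ suc n) ℤ.* (ℤ.+ suc b) ≡ (ℤ.+ 1) ℤ.* (ℤ.+ (suc b * suc n))
  cross = trans (sym (ℤ.pos-* (suc n) (suc b)))
                (trans (cong ℤ.+_ (ℕ.*-comm (suc n) (suc b))) (sym (ℤ.*-identityˡ _)))

⊛-1/-self : ∀ n → 1 ≤ n → (n ⊛ 1/ n) ℚ.≃ 1ℚᵘ
⊛-1/-self n 1≤n = subst (λ z → (n ⊛ 1/ z) ℚ.≃ 1ℚᵘ) (ℕ.*-identityˡ n)
                        (⊛-1/-cancelʳ n 1 1≤n (s≤s z≤n))

1/-antitone : ∀ {a c} → 1 ≤ a → a < c → 1/ c ℚ.< 1/ a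
1/-antitone {suc a} {suc c} _ a<c = *<* (subst₂ ℤ._<_ (sym (ℤ.*-identityˡ _)) (sym (ℤ.*-identityˡ _))
                                                    (ℤ.+<+ a<c))

1/-nonneg : ∀ a → 0ℚᵘ ℚ.≤ 1/ a
1/-nonneg zero    = ℚ.≤-refl
1/-nonneg (suc a) = *≤* (ℤ.+≤+ z≤n)

sum-if : ∀ {k} (c : Fin k → Bool) q → sum (λ i → if c i then q else 0ℚᵘ) ℚ.≃ (countF c ⊛ q)
sum-if {zero}  c q = ℚ.≃-refl
sum-if {suc k} c q with c zero
... | true  = ℚ.+-congʳ q (sum-if (λ i → c (suc i)) q)
... | false = ℚ.≃-trans (ℚ.+-identityˡ _) (sum-if (λ i → c (suc i)) q)

sum-mono-≤ : ∀ {k} {f g : Fin k → ℚᵘ} → (∀ i → f i ℚ.≤ g i) → sum f ℚ.≤ sum g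
sum-mono-≤ {zero}  h = ℚ.≤-refl
sum-mono-≤ {suc k} h = ℚ.+-mono-≤ (h zero) (sum-mono-≤ (λ i → h (suc i)))

sum-mono-< : ∀ {k} {f g : Fin k → ℚᵘ} → (∀ i → f i ℚ.≤ g i) → ∀ a → f a ℚ.< g a → sum f ℚ.< sum g
sum-mono-< {suc k} h zero    lt = ℚ.+-mono-<-≤ lt (sum-mono-≤ (λ i → h (suc i)))
sum-mono-< {suc k} h (suc a) lt = ℚ.+-mono-≤-< (h zero) (sum-mono-< (λ i → h (suc i)) a lt)

conway-arith : ∀ {v b k r V B} → b < v → 1 ≤ k → k ≤ r → V + k ≡ v → B + r ≡ b → v * B < b * V
conway-arith {r = zero} _ (s≤s _) () _ _
conway-arith {v} {b} {k} {suc r} {V} {B} b<v _ k≤r refl refl =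
  ℕ.+-cancelʳ-< (v * suc r) (v * B) (b * V) (begin-strict
    v * B + v * suc r    ≡⟨ sym (ℕ.*-distribˡ-+ v B (suc r)) ⟩
    v * (B + suc r)      ≡⟨ ℕ.*-comm v (B + suc r) ⟩
    (B + suc r) * v      ≡⟨ ℕ.*-distribˡ-+ (B + suc r) V k ⟩
    b * V + b * k        <⟨ ℕ.+-monoʳ-< (b * V) bk<vr ⟩
    b * V + v * suc r    ∎)
  where
  open ℕ.≤-Reasoning
  bk<vr : b * k < v * suc r
  bk<vr = ℕ.≤-<-trans (ℕ.*-monoʳ-≤ b k≤r) (ℕ.*-monoˡ-< (suc r) b<v)

module DeBruijnErdős {M p : ℕ} (sel : Fin M → Bool) (A : Fin M → Fin p → Bool)
  (meet-once : ∀ i j → sel i ≡ true → sel j ≡ true → i ≢ j → countF (λ x → A i x ∧ A j x) ≡ 1)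
  (distinct : ∀ i j → sel i ≡ true → sel j ≡ true → i ≢ j →
              (∃ λ x → A i x ≡ true × A j x ≡ false) ⊎ (∃ λ x → A j x ≡ true × A i x ≡ false))
  where

  covered : Fin p → Bool
  covered x = anyF (λ i → sel i ∧ A i x)

  covered⁺ : ∀ {i x} → sel i ≡ true → A i x ≡ true → covered x ≡ true
  covered⁺ {i} si aix = anyF⁺ _ i (∧-true⁺ si aix)

  meet-unique : ∀ {i j x y} → sel i ≡ true → sel j ≡ true → i ≢ j →
                A i x ≡ true → A j x ≡ true → A i y ≡ true → A j y ≡ true → x ≡ y
  meet-unique {i} {j} {x} {y} si sj i≢j aix ajx aiy ajy with x ≟ y
  ... | yes x≡y = x≡y
  ... | no  x≢y = ⊥-elim (ℕ.<-irrefl (sym (meet-once i j si sj i≢j))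
                           (countF-two⁺ _ x y x≢y (∧-true⁺ aix ajx) (∧-true⁺ aiy ajy)))

  -- If all members pass through c, send each member to one of its points other than c
  -- (or to c itself when it is {c}); simplicity and distinctness make this injective.
  module WithCommonPoint (c : Fin p) (through-c : ∀ i → sel i ≡ true → A i c ≡ true) where

    private
      besides-c : Fin M → Fin p → Bool
      besides-c i = A i without c

      other : Fin M → Fin p
      other i = choose (besides-c i) c

      ≡c-if-none-besides : ∀ i → (∀ y → besides-c i y ≡ false) → ∀ y → A i y ≡ true → y ≡ c
      ≡c-if-none-besides i none y aiy with y ≟ c
      ... | yes y≡c = y≡c
      ... | no  y≢c = ⊥-elim (true≢false (∧-true⁺ aiy (not-true⁺ (⌊⌋-false⁺ (y ≟ c) y≢c)))
                                         (none y))

      other-∈ : ∀ i → sel i ≡ true → A i (other i) ≡ true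
      other-∈ i si with choose-spec (besides-c i) c
      ... | inj₁ e       = proj₁ (∧-true⁻ e)
      ... | inj₂ (_ , e) = subst (λ z → A i z ≡ true) (sym e) (through-c i si)

      other-≢c : ∀ i → besides-c i (other i) ≡ true → other i ≢ c
      other-≢c i e o≡c = true≢false (proj₂ (∧-true⁻ e))
                           (cong not (≟-true⁺ o≡c))

      other-injective : ∀ i j → sel i ≡ true → sel j ≡ true → other i ≡ other j → i ≡ j
      other-injective i j si sj e with i ≟ j
      ... | yes i≡j = i≡j
      ... | no  i≢j with choose-spec (besides-c i) c | choose-spec (besides-c j) c
      ...   | inj₁ bi | inj₁ _ = ⊥-elim (other-≢c i bi (meet-unique si sj i≢j (other-∈ i si)
                                   (subst (λ z → A j z ≡ true) (sym e) (other-∈ j sj))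
                                   (through-c i si) (through-c j sj)))
      ...   | inj₁ bi | inj₂ (_ , ej) = ⊥-elim (other-≢c i bi (trans e ej))
      ...   | inj₂ (_ , ei) | inj₁ bj = ⊥-elim (other-≢c j bj (trans (sym e) ei))
      ...   | inj₂ (ni , _) | inj₂ (nj , _) with distinct i j si sj i≢j
      ...     | inj₁ (x , aix , ajx) = ⊥-elim (true≢false (through-c j sj)
                                         (subst (λ z → A j z ≡ false) (≡c-if-none-besides i ni x aix) ajx))
      ...     | inj₂ (x , ajx , aix) = ⊥-elim (true≢false (through-c i si)
                                         (subst (λ z → A i z ≡ false) (≡c-if-none-besides j nj x ajx) aix))

    bound : countF sel ≤ countF covered
    bound = countF-injection sel covered (λ i _ → other i)
                             (λ i si → covered⁺ si (other-∈ i si)) other-injective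

  -- Conway's double count. Call the members lines and the covered elements points (v lines,
  -- b points), and weight each pair (i, x) with x off line i by 1/(b · linesMissing x) (total
  -- exactly 1) and by 1/(v · pointsOff i) (total at most 1). Since linesThrough x ≤ pointsOn i
  -- for such pairs, b < v would make every second weight strictly larger.
  module WithoutCommonPoint (two : 2 ≤ countF sel)
                            (missed : ∀ x → ∃ λ i → sel i ≡ true × A i x ≡ false)
                            (b<v : countF covered < countF sel) where

    v b : ℕ
    v = countF sel
    b = countF covered

    linesThrough : Fin p → ℕ
    linesThrough x = countF (λ i → sel i ∧ A i x)

    pointsOn : Fin M → ℕ
    pointsOn i = countF (λ x → covered x ∧ A i x)

    Off : Fin M → Fin p → Bool
    Off i x = sel i ∧ (covered x ∧ not (A i x))

    linesMissing : Fin p → ℕ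
    linesMissing x = countF (λ i → Off i x)

    pointsOff : Fin M → ℕ
    pointsOff i = countF (Off i)

    Off⁻ : ∀ {i x} → Off i x ≡ true → sel i ≡ true × covered x ≡ true × A i x ≡ false
    Off⁻ e with ∧-true⁻ e
    ... | si , rest with ∧-true⁻ rest
    ...   | cx , nax = si , cx , not-true⁻ nax

    Off⁺ : ∀ {i x} → sel i ≡ true → covered x ≡ true → A i x ≡ false → Off i x ≡ true
    Off⁺ si cx aix = ∧-true⁺ si (∧-true⁺ cx (not-true⁺ aix))

    linesMissing+linesThrough : ∀ x → covered x ≡ true → linesMissing x + linesThrough x ≡ v
    linesMissing+linesThrough x cx = trans (+-comm (linesMissing x) _)
      (trans (cong (_+_ (linesThrough x)) (countF-cong (λ i → cong (λ z → sel i ∧ (z ∧ not (A i x))) cx)))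
             (countF-split sel (λ i → A i x)))

    pointsOff+pointsOn : ∀ i → sel i ≡ true → pointsOff i + pointsOn i ≡ b
    pointsOff+pointsOn i si = trans (+-comm (pointsOff i) _)
      (trans (cong (_+_ (pointsOn i)) (countF-cong (λ x → cong (λ z → z ∧ (covered x ∧ not (A i x))) si)))
             (countF-split covered (λ x → A i x)))

    linesMissing-uncovered : ∀ x → covered x ≡ false → linesMissing x ≡ 0
    linesMissing-uncovered x ux = countF-false _ (λ i →
      trans (cong (λ z → sel i ∧ (z ∧ not (A i x))) ux) (∧-zeroʳ (sel i)))

    pointsOff-unselected : ∀ i → sel i ≡ false → pointsOff i ≡ 0
    pointsOff-unselected i ui = countF-false _ (λ x → cong (λ z → z ∧ (covered x ∧ not (A i x))) ui)

    linesThrough-pos : ∀ x → covered x ≡ true → 1 ≤ linesThrough x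
    linesThrough-pos x cx with anyF⁻ (λ i → sel i ∧ A i x) cx
    ... | i , e = countF-pos⁺ (λ i → sel i ∧ A i x) i e

    linesMissing-pos : ∀ x → covered x ≡ true → 1 ≤ linesMissing x
    linesMissing-pos x cx with missed x
    ... | i , si , aix = countF-pos⁺ _ i (Off⁺ si cx aix)

    pointsOff-pos : ∀ i x → Off i x ≡ true → 1 ≤ pointsOff i
    pointsOff-pos i x = countF-pos⁺ _ x

    -- Each line through x meets line i in a point, and distinct lines through x meet it in
    -- distinct points since x is not on line i.
    linesThrough≤pointsOn : ∀ i x → Off i x ≡ true → linesThrough x ≤ pointsOn i
    linesThrough≤pointsOn i x off = countF-injection _ _ meet maps-on injective
      where
      si = proj₁ (Off⁻ off)
      aix = proj₂ (proj₂ (Off⁻ off))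

      through⇒≢i : ∀ j → sel j ∧ A j x ≡ true → i ≢ j
      through⇒≢i j t refl = true≢false (proj₂ (∧-true⁻ t)) aix

      meeting : ∀ j → sel j ∧ A j x ≡ true → ∃ λ y → A i y ∧ A j y ≡ true
      meeting j t = countF-pos⁻ _
        (≤-reflexive (sym (meet-once i j si (proj₁ (∧-true⁻ t)) (through⇒≢i j t))))

      meet : ∀ j → sel j ∧ A j x ≡ true → Fin p
      meet j t = proj₁ (meeting j t)

      meet-∈ : ∀ j t → A i (meet j t) ∧ A j (meet j t) ≡ true
      meet-∈ j t = proj₂ (meeting j t)

      maps-on : ∀ j t → covered (meet j t) ∧ A i (meet j t) ≡ true
      maps-on j t = ∧-true⁺ (covered⁺ si on-i) on-i
        where on-i = proj₁ (∧-true⁻ (meet-∈ j t))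

      injective : ∀ j j' t t' → meet j t ≡ meet j' t' → j ≡ j'
      injective j j' t t' e with j ≟ j'
      ... | yes j≡j' = j≡j'
      ... | no  j≢j' = ⊥-elim (true≢false
                         (subst (λ z → A i z ≡ true) (sym x≡meet) (proj₁ (∧-true⁻ (meet-∈ j t)))) aix)
        where
        x≡meet : x ≡ meet j t
        x≡meet = meet-unique (proj₁ (∧-true⁻ t)) (proj₁ (∧-true⁻ t')) j≢j'
                   (proj₂ (∧-true⁻ t)) (proj₂ (∧-true⁻ t')) (proj₂ (∧-true⁻ (meet-∈ j t)))
                   (subst (λ z → A j' z ≡ true) (sym e) (proj₂ (∧-true⁻ (meet-∈ j' t'))))

    off-pair : ∃ λ i → ∃ λ x → Off i x ≡ true
    off-pair with countF-two⁻ sel two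
    ... | i , j , i≢j , si , sj with distinct i j si sj i≢j
    ...   | inj₁ (x , aix , ajx) = j , x , Off⁺ sj (covered⁺ si aix) ajx
    ...   | inj₂ (x , ajx , aix) = i , x , Off⁺ si (covered⁺ sj ajx) aix

    1≤b : 1 ≤ b
    1≤b with off-pair
    ... | _ , x , off = countF-pos⁺ covered x (proj₁ (proj₂ (Off⁻ off)))

    1≤v : 1 ≤ v
    1≤v = ≤-trans (s≤s z≤n) two

    pointWeight lineWeight : Fin M → Fin p → ℚᵘ
    pointWeight i x = if Off i x then 1/ (b * linesMissing x) else 0ℚᵘ
    lineWeight  i x = if Off i x then 1/ (v * pointsOff i) else 0ℚᵘ

    pointWeight-column : ∀ x → sum (λ i → pointWeight i x) ℚ.≃ (if covered x then 1/ b else 0ℚᵘ)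
    pointWeight-column x with true-or-false (covered x)
    ... | inj₁ cx = subst (λ c → sum (λ i → pointWeight i x) ℚ.≃ (if c then 1/ b else 0ℚᵘ)) (sym cx)
                      (ℚ.≃-trans (sum-if (λ i → Off i x) _)
                                 (⊛-1/-cancelʳ (linesMissing x) b (linesMissing-pos x cx) 1≤b))
    ... | inj₂ ux = subst (λ c → sum (λ i → pointWeight i x) ℚ.≃ (if c then 1/ b else 0ℚᵘ)) (sym ux)
                      (ℚ.≃-trans (sum-if (λ i → Off i x) _)
                                 (ℚ.≃-reflexive (cong (λ n → n ⊛ 1/ (b * linesMissing x))
                                                      (linesMissing-uncovered x ux))))

    lineWeight-row : ∀ i → sum (lineWeight i) ℚ.≤ (if sel i then 1/ v else 0ℚᵘ)
    lineWeight-row i = ℚ.≤-trans (ℚ.≤-reflexive (sum-if (Off i) _)) (bound (sel i) refl)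
      where
      bound : ∀ s → sel i ≡ s → (pointsOff i ⊛ 1/ (v * pointsOff i)) ℚ.≤ (if s then 1/ v else 0ℚᵘ)
      bound false ui rewrite pointsOff-unselected i ui = ℚ.≤-refl
      bound true  _ with pointsOff i
      ... | zero  = 1/-nonneg v
      ... | suc n = ℚ.≤-reflexive (⊛-1/-cancelʳ (suc n) v (s≤s z≤n) 1≤v)

    pointWeight<lineWeight : ∀ i x → Off i x ≡ true →
                             1/ (b * linesMissing x) ℚ.< 1/ (v * pointsOff i)
    pointWeight<lineWeight i x off = 1/-antitone (ℕ.*-mono-≤ 1≤v (pointsOff-pos i x off))
      (conway-arith b<v (linesThrough-pos x cx) (linesThrough≤pointsOn i x off)
                    (linesMissing+linesThrough x cx) (pointsOff+pointsOn i si))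
      where
      si = proj₁ (Off⁻ off)
      cx = proj₁ (proj₂ (Off⁻ off))

    pointWeight≤lineWeight : ∀ i x → pointWeight i x ℚ.≤ lineWeight i x
    pointWeight≤lineWeight i x with true-or-false (Off i x)
    ... | inj₁ off rewrite off = ℚ.<⇒≤ (pointWeight<lineWeight i x off)
    ... | inj₂ ¬off rewrite ¬off = ℚ.≤-refl

    total-pointWeight≃1 : sum (λ i → sum (pointWeight i)) ℚ.≃ 1ℚᵘ
    total-pointWeight≃1 = ℚ.≃-trans (∑-comm pointWeight)
      (ℚ.≃-trans (sum-cong-≋ pointWeight-column)
        (ℚ.≃-trans (sum-if covered (1/ b)) (⊛-1/-self b 1≤b)))

    total-lineWeight≤1 : sum (λ i → sum (lineWeight i)) ℚ.≤ 1ℚᵘ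
    total-lineWeight≤1 = ℚ.≤-trans (sum-mono-≤ lineWeight-row)
      (ℚ.≤-reflexive (ℚ.≃-trans (sum-if sel (1/ v)) (⊛-1/-self v 1≤v)))

    total-pointWeight<total-lineWeight : sum (λ i → sum (pointWeight i)) ℚ.< sum (λ i → sum (lineWeight i))
    total-pointWeight<total-lineWeight with off-pair
    ... | i , x , off = sum-mono-< (λ j → sum-mono-≤ (pointWeight≤lineWeight j)) i
                          (sum-mono-< (pointWeight≤lineWeight i) x strict)
      where
      strict : pointWeight i x ℚ.< lineWeight i x
      strict rewrite off = pointWeight<lineWeight i x off

    impossible : ⊥
    impossible = ℚ.<-irrefl ℚ.≃-refl (ℚ.≤-<-trans (ℚ.≤-reflexive (ℚ.≃-sym total-pointWeight≃1))
                   (ℚ.<-≤-trans total-pointWeight<total-lineWeight total-lineWeight≤1))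

  deBruijnErdős : 2 ≤ countF sel → countF sel ≤ countF covered
  deBruijnErdős two with decideAnyF (λ c → allF (λ i → not (sel i) ∨ A i c))
  ... | inj₁ (c , through-all) = WithCommonPoint.bound c through-c
    where
    through-c : ∀ i → sel i ≡ true → A i c ≡ true
    through-c i si with allF⁻ _ through-all i
    ... | e rewrite si = e
  ... | inj₂ none with countF sel ≤? countF covered
  ...   | yes le = le
  ...   | no  nle = ⊥-elim (WithoutCommonPoint.impossible two missed (ℕ.≰⇒> nle))
    where
    missed : ∀ x → ∃ λ i → sel i ≡ true × A i x ≡ false
    missed x with allF-false⁻ _ (none x)
    ... | i , e = i , implication-false⁻ (sel i) (A i x) e

∈?-∩ : ∀ {p} (A B : Subset p) j → ⌊ j ∈? A ∩ B ⌋ ≡ ⌊ j ∈? A ⌋ ∧ ⌊ j ∈? B ⌋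
∈?-∩ A B j with j ∈? A | j ∈? B
... | yes a | yes b = ⌊⌋-true⁺ (j ∈? A ∩ B) (x∈p∩q⁺ (a , b))
... | yes _ | no ¬b = ⌊⌋-false⁺ (j ∈? A ∩ B) (¬b ∘ proj₂ ∘ x∈p∩q⁻ A B)
... | no ¬a | _     = ⌊⌋-false⁺ (j ∈? A ∩ B) (¬a ∘ proj₁ ∘ x∈p∩q⁻ A B)

∈?-suc : ∀ {p} j (A : Subset p) {x} → ⌊ suc j ∈? (x ∷ A) ⌋ ≡ ⌊ j ∈? A ⌋
∈?-suc j A = ⌊⌋-map′ _ _ (j ∈? A)

∣∣≡countF : ∀ {p} (A : Subset p) → ∣ A ∣ ≡ countF (λ j → ⌊ j ∈? A ⌋)
∣∣≡countF []            = refl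
∣∣≡countF (inside ∷ A)  = cong suc (trans (∣∣≡countF A) (countF-cong (λ j → sym (∈?-suc j A))))
∣∣≡countF (outside ∷ A) = trans (∣∣≡countF A) (countF-cong (λ j → sym (∈?-suc j A)))

∣∩∣≡countF : ∀ {p} (A B : Subset p) → ∣ A ∩ B ∣ ≡ countF (λ j → ⌊ j ∈? A ⌋ ∧ ⌊ j ∈? B ⌋)
∣∩∣≡countF A B = trans (∣∣≡countF (A ∩ B)) (countF-cong (∈?-∩ A B))

⊈⇒witness : ∀ {p} (A B : Subset p) → ¬ (A ⊆ B) → ∃ λ j → ⌊ j ∈? A ⌋ ≡ true × ⌊ j ∈? B ⌋ ≡ false
⊈⇒witness A B A⊈B with decideAnyF (λ j → ⌊ j ∈? A ⌋ ∧ not ⌊ j ∈? B ⌋)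
... | inj₁ (j , e) = j , proj₁ (∧-true⁻ e) , not-true⁻ (proj₂ (∧-true⁻ e))
... | inj₂ none    = ⊥-elim (A⊈B (λ {j} j∈A →
                        ⌊⌋-true⁻ (j ∈? B) (in-B j (⌊⌋-true⁺ (j ∈? A) j∈A))))
  where
  in-B : ∀ j → ⌊ j ∈? A ⌋ ≡ true → ⌊ j ∈? B ⌋ ≡ true
  in-B j a with true-or-false ⌊ j ∈? B ⌋
  ... | inj₁ b = b
  ... | inj₂ b = ⊥-elim (true≢false (∧-true⁺ a (not-true⁺ b)) (none j))

module GraphProperties (G : Graph) where
  open Graph G

  Joins : Fin m → Fin n → Fin n → Set
  Joins e a b = (src e ≡ a × tgt e ≡ b) ⊎ (src e ≡ b × tgt e ≡ a)

  joins⇒incidentˡ : ∀ {e a b} → Joins e a b → Incident G e a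
  joins⇒incidentˡ (inj₁ (s , _)) = inj₁ s
  joins⇒incidentˡ (inj₂ (_ , t)) = inj₂ t

  joins⇒incidentʳ : ∀ {e a b} → Joins e a b → Incident G e b
  joins⇒incidentʳ (inj₁ (_ , t)) = inj₂ t
  joins⇒incidentʳ (inj₂ (s , _)) = inj₁ s

  joins⇒≢ : ∀ {e a b} → Joins e a b → a ≢ b
  joins⇒≢ {e} (inj₁ (s , t)) a≡b = loopless e (trans s (trans a≡b (sym t)))
  joins⇒≢ {e} (inj₂ (s , t)) a≡b = loopless e (trans s (trans (sym a≡b) (sym t)))

  joins-incident : ∀ {e a b u} → Joins e a b → Incident G e u → u ≡ a ⊎ u ≡ b
  joins-incident (inj₁ (s , t)) (inj₁ s') = inj₁ (trans (sym s') s)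
  joins-incident (inj₁ (s , t)) (inj₂ t') = inj₂ (trans (sym t') t)
  joins-incident (inj₂ (s , t)) (inj₁ s') = inj₂ (trans (sym s') s)
  joins-incident (inj₂ (s , t)) (inj₂ t') = inj₁ (trans (sym t') t)

  incB⁺ : ∀ {e v} → Incident G e v → incB G e v ≡ true
  incB⁺ (inj₁ s) = ∨-true⁺ˡ _ (≟-true⁺ s)
  incB⁺ (inj₂ t) = ∨-true⁺ʳ _ (≟-true⁺ t)

  joinsB : Fin m → Fin n → Fin n → Bool
  joinsB e a b = (⌊ src e ≟ a ⌋ ∧ ⌊ tgt e ≟ b ⌋) ∨ (⌊ src e ≟ b ⌋ ∧ ⌊ tgt e ≟ a ⌋)

  joinsB⁻ : ∀ {e a b} → joinsB e a b ≡ true → Joins e a b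
  joinsB⁻ j with ∨-true⁻ j
  ... | inj₁ st = inj₁ (≟-true⁻ (proj₁ (∧-true⁻ st)) , ≟-true⁻ (proj₂ (∧-true⁻ st)))
  ... | inj₂ st = inj₂ (≟-true⁻ (proj₁ (∧-true⁻ st)) , ≟-true⁻ (proj₂ (∧-true⁻ st)))

  joinsB⁺ : ∀ {e a b} → Joins e a b → joinsB e a b ≡ true
  joinsB⁺ (inj₁ (s , t)) = ∨-true⁺ˡ _ (∧-true⁺ (≟-true⁺ s) (≟-true⁺ t))
  joinsB⁺ (inj₂ (s , t)) = ∨-true⁺ʳ _ (∧-true⁺ (≟-true⁺ s) (≟-true⁺ t))

  adjB⁻ : ∀ {a b} → adjB G a b ≡ true → ∃ λ e → Joins e a b
  adjB⁻ t with anyF⁻ _ t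
  ... | e , j = e , joinsB⁻ j

  adjB⁺ : ∀ {e a b} → Joins e a b → adjB G a b ≡ true
  adjB⁺ {e} j = anyF⁺ _ e (joinsB⁺ j)

  2≤deg : ∀ {e e' u} → e ≢ e' → Incident G e u → Incident G e' u → 2 ≤ deg G u
  2≤deg {e} {e'} e≢e' i i' = countF-two⁺ _ e e' e≢e' (incB⁺ i) (incB⁺ i')

  plume-deg : ∀ {u} → isPlume G u ≡ true → deg G u ≡ 1
  plume-deg {u} e = ℕ.≡ᵇ⇒≡ (deg G u) 1 (Equivalence.from T-≡ e)

  plume-edge-unique : ∀ {u e e'} → isPlume G u ≡ true → Incident G e u → Incident G e' u → e ≡ e'
  plume-edge-unique {e = e} {e'} pl i i' with e ≟ e'
  ... | yes e≡e' = e≡e'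
  ... | no  e≢e' = ⊥-elim (ℕ.<-irrefl (sym (plume-deg pl)) (2≤deg e≢e' i i'))

  critical⇒2≤deg : ∀ {v} → isCritical G v ≡ true → 2 ≤ deg G v
  critical⇒2≤deg {v} c = ℕ.≤ᵇ⇒≤ 2 (deg G v) (Equivalence.from T-≡ (proj₁ (∧-true⁻ c)))

  critical⇒hasPlume : ∀ {v} → isCritical G v ≡ true → hasPlume G v ≡ true
  critical⇒hasPlume c = proj₂ (∧-true⁻ c)

  plume≢critical : ∀ {u v} → isPlume G u ≡ true → isCritical G v ≡ true → u ≢ v
  plume≢critical pl c refl = ℕ.<-irrefl (sym (plume-deg pl)) (critical⇒2≤deg c)

  plumeEdgeAt : Fin n → Fin m → Bool
  plumeEdgeAt v e = (⌊ src e ≟ v ⌋ ∧ isPlume G (tgt e)) ∨ (⌊ tgt e ≟ v ⌋ ∧ isPlume G (src e))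

  plumeEdgeAt⁻ : ∀ {v e} → plumeEdgeAt v e ≡ true → ∃ λ x → isPlume G x ≡ true × Joins e v x
  plumeEdgeAt⁻ {e = e} t with ∨-true⁻ t
  ... | inj₁ sp = tgt e , proj₂ (∧-true⁻ sp) , inj₁ (≟-true⁻ (proj₁ (∧-true⁻ sp)) , refl)
  ... | inj₂ tp = src e , proj₂ (∧-true⁻ tp) , inj₂ (refl , ≟-true⁻ (proj₁ (∧-true⁻ tp)))

  plumeEdgeAt⁺ : ∀ {v e x} → isPlume G x ≡ true → Joins e v x → plumeEdgeAt v e ≡ true
  plumeEdgeAt⁺ pl (inj₁ (s , refl)) = ∨-true⁺ˡ _ (∧-true⁺ (≟-true⁺ s) pl)
  plumeEdgeAt⁺ pl (inj₂ (refl , t)) = ∨-true⁺ʳ _ (∧-true⁺ (≟-true⁺ t) pl)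

  plumeEdgeAt⇒incident : ∀ {v e} → plumeEdgeAt v e ≡ true → Incident G e v
  plumeEdgeAt⇒incident t = joins⇒incidentˡ (proj₂ (proj₂ (plumeEdgeAt⁻ t)))

  -- The far end of a plume edge at v has no other edge, so e can only meet it at v.
  meets-plumeEdge⇒incident : ∀ {v e₀ e} → plumeEdgeAt v e₀ ≡ true → LineAdj G e e₀ → Incident G e v
  meets-plumeEdge⇒incident t (u , eu , e₀u) with plumeEdgeAt⁻ t
  ... | x , pl , j with joins-incident j e₀u
  ...   | inj₁ refl = eu
  ...   | inj₂ refl = subst (λ e → Incident G e _) (sym (plume-edge-unique pl eu e₀u)) (joins⇒incidentˡ j)

  module AllNeighboursPlumes (v : Fin n) (plumes : ∀ w → adjB G v w ≡ true → isPlume G w ≡ true) where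

    closed-neighbourhood-closed : ∀ {a u} → (a ≡ v ⊎ Adj G v a) → Star (Adj G) a u → (u ≡ v ⊎ Adj G v u)
    closed-neighbourhood-closed a∈N ε = a∈N
    closed-neighbourhood-closed (inj₁ refl) (va ◅ path) = closed-neighbourhood-closed (inj₂ va) path
    closed-neighbourhood-closed {a} (inj₂ (e₀ , j₀)) ((e , j) ◅ path) =
      closed-neighbourhood-closed (inj₁ next≡v) path
      where
      e≡e₀ : e ≡ e₀
      e≡e₀ = plume-edge-unique (plumes a (adjB⁺ j₀)) (joins⇒incidentˡ j) (joins⇒incidentʳ j₀)
      next≡v : _ ≡ v
      next≡v with joins-incident j₀ (subst (λ e → Incident G e _) e≡e₀ (joins⇒incidentʳ j))
      ... | inj₁ q = q
      ... | inj₂ q = ⊥-elim (joins⇒≢ j (sym q))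

    isStar : Connected G → IsStar G
    isStar connected = v , adjacent , incident
      where
      reach : ∀ u → u ≡ v ⊎ Adj G v u
      reach u = closed-neighbourhood-closed (inj₁ refl) (connected v u)

      adjacent : ∀ w → w ≢ v → Adj G v w
      adjacent w w≢v with reach w
      ... | inj₁ w≡v = ⊥-elim (w≢v w≡v)
      ... | inj₂ vw  = vw

      incident : ∀ e → Incident G e v
      incident e with reach (src e)
      ... | inj₁ s≡v       = inj₁ s≡v
      ... | inj₂ (e₀ , j₀) = subst (λ e → Incident G e v)
              (sym (plume-edge-unique (plumes (src e) (adjB⁺ j₀)) (inj₁ refl) (joins⇒incidentʳ j₀)))
              (joins⇒incidentˡ j₀)

  nonPlume-neighbour : Connected G → ¬ IsStar G → ∀ v →
                       ∃ λ w → ∃ λ f → Joins f v w × isPlume G w ≡ false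
  nonPlume-neighbour connected ¬star v with decideAnyF (λ w → adjB G v w ∧ not (isPlume G w))
  ... | inj₁ (w , t) with adjB⁻ (proj₁ (∧-true⁻ t))
  ...   | f , j = w , f , j , not-true⁻ (proj₂ (∧-true⁻ t))
  nonPlume-neighbour connected ¬star v | inj₂ none =
    ⊥-elim (¬star (AllNeighboursPlumes.isStar v plumes connected))
    where
    plumes : ∀ w → adjB G v w ≡ true → isPlume G w ≡ true
    plumes w a with true-or-false (isPlume G w)
    ... | inj₁ pl = pl
    ... | inj₂ np = ⊥-elim (true≢false (∧-true⁺ a (not-true⁺ np)) (none w))

  plumesAt≤plumeEdges : ∀ v → plumesAt G v ≤ countF (plumeEdgeAt v)
  plumesAt≤plumeEdges v = countF-injection _ _ edge plumeEdge injective
    where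
    edge-joins : ∀ x → isPlume G x ∧ adjB G v x ≡ true → ∃ λ e → Joins e v x
    edge-joins x t = adjB⁻ (proj₂ (∧-true⁻ t))

    edge : ∀ x → isPlume G x ∧ adjB G v x ≡ true → Fin m
    edge x t = proj₁ (edge-joins x t)

    plumeEdge : ∀ x t → plumeEdgeAt v (edge x t) ≡ true
    plumeEdge x t = plumeEdgeAt⁺ (proj₁ (∧-true⁻ t)) (proj₂ (edge-joins x t))

    injective : ∀ x x' t t' → edge x t ≡ edge x' t' → x ≡ x'
    injective x x' t t' e
      with joins-incident (proj₂ (edge-joins x t))
                          (subst (λ e → Incident G e x') (sym e) (joins⇒incidentʳ (proj₂ (edge-joins x' t'))))
    ... | inj₁ x'≡v = ⊥-elim (joins⇒≢ (proj₂ (edge-joins x' t')) (sym x'≡v))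
    ... | inj₂ x'≡x = sym x'≡x

module StarPoints (G : Graph) {p : ℕ} (S : Fin (Graph.m G) → Subset p)
                  (sar : SimpleAntichainRep (LineAdj G) p S) where
  open Graph G
  open GraphProperties G
  open SimpleAntichainRep sar

  _∈S_ : Fin p → Fin m → Bool
  j ∈S e = ⌊ j ∈? S e ⌋

  -- j is a star point of v when the clique Q_j of EGP(S) contains a plume edge at v.
  starPoint : Fin n → Fin p → Bool
  starPoint v j = anyF (λ e → plumeEdgeAt v e ∧ (j ∈S e))

  starPoint⁺ : ∀ {v e j} → plumeEdgeAt v e ≡ true → j ∈S e ≡ true → starPoint v j ≡ true
  starPoint⁺ {e = e} pe j∈e = anyF⁺ _ e (∧-true⁺ pe j∈e)

  common-point⇒lineAdj : ∀ {e e' j} → e ≢ e' → j ∈S e ≡ true → j ∈S e' ≡ true → LineAdj G e e'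
  common-point⇒lineAdj {e} {e'} {j} e≢e' j∈e j∈e' =
    Equivalence.from (SetRep.represents rep e e' e≢e')
      (j , x∈p∩q⁺ (⌊⌋-true⁻ (j ∈? S e) j∈e , ⌊⌋-true⁻ (j ∈? S e') j∈e'))

  lineAdj⇒meet-once : ∀ {e e'} → e ≢ e' → LineAdj G e e' → countF (λ j → (j ∈S e) ∧ (j ∈S e')) ≡ 1
  lineAdj⇒meet-once {e} {e'} e≢e' adj = ℕ.≤-antisym
    (subst (_≤ 1) (∣∩∣≡countF (S e) (S e')) (simple e e' e≢e'))
    (subst (1 ≤_) (∣∩∣≡countF (S e) (S e'))
                  (nonempty-size (Equivalence.to (SetRep.represents rep e e' e≢e') adj)))
    where
    nonempty-size : Nonempty (S e ∩ S e') → 1 ≤ ∣ S e ∩ S e' ∣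
    nonempty-size (j , j∈) = subst (1 ≤_) (sym (∣∣≡countF (S e ∩ S e')))
                                   (countF-pos⁺ _ j (⌊⌋-true⁺ (j ∈? S e ∩ S e') j∈))

  starPoint⇒incident : ∀ {v j e} → starPoint v j ≡ true → j ∈S e ≡ true → Incident G e v
  starPoint⇒incident {e = e} sp j∈e with anyF⁻ _ sp
  ... | e₀ , t with e ≟ e₀
  ...   | yes refl = plumeEdgeAt⇒incident (proj₁ (∧-true⁻ t))
  ...   | no  e≢e₀ = meets-plumeEdge⇒incident (proj₁ (∧-true⁻ t))
                       (common-point⇒lineAdj e≢e₀ j∈e (proj₂ (∧-true⁻ t)))

  criticalStarPoint : Fin n → Fin p → Bool
  criticalStarPoint v j = isCritical G v ∧ starPoint v j

  criticalStarPoint⇒inPc : ∀ {v j} → criticalStarPoint v j ≡ true → inPc G S j ≡ true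
  criticalStarPoint⇒inPc {v} {j} c = anyF⁺ _ v (∧-true⁺ (proj₁ (∧-true⁻ c)) (allF⁺ _ all-at-v))
    where
    all-at-v : ∀ e → not (j ∈S e) ∨ incB G e v ≡ true
    all-at-v e with true-or-false (j ∈S e)
    ... | inj₁ j∈e rewrite j∈e = incB⁺ (starPoint⇒incident (proj₂ (∧-true⁻ c)) j∈e)
    ... | inj₂ j∉e rewrite j∉e = refl

  -- A plume edge at w carrying j joins w to a plume, so it can only be incident with the
  -- critical vertex v at w.
  criticalStarPoint-unique : ∀ v w j → criticalStarPoint v j ≡ true → criticalStarPoint w j ≡ true → v ≡ w
  criticalStarPoint-unique v w j cv cw
    with anyF⁻ (λ e → plumeEdgeAt w e ∧ (j ∈S e)) (proj₂ (∧-true⁻ {isCritical G w} cw))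
  ... | e , t with plumeEdgeAt⁻ (proj₁ (∧-true⁻ t))
  ...   | x , pl , joins
    with joins-incident joins (starPoint⇒incident (proj₂ (∧-true⁻ cv)) (proj₂ (∧-true⁻ t)))
  ...     | inj₁ v≡w = v≡w
  ...     | inj₂ v≡x = ⊥-elim (plume≢critical pl (proj₁ (∧-true⁻ cv)) (sym v≡x))

  -- The family is S_e for the plume edges e at v and the edge f from v to a non-plume w, cut
  -- down to starPoint v: of two members one is a plume edge, so their common point survives,
  -- while the union now lies in starPoint v.
  module AtCriticalVertex (v : Fin n) (critical : isCritical G v ≡ true) (w : Fin n) (f : Fin m)
                          (f-joins : Joins f v w) (w-nonPlume : isPlume G w ≡ false) where

    selected : Fin m → Bool
    selected e = plumeEdgeAt v e ∨ ⌊ e ≟ f ⌋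

    A : Fin m → Fin p → Bool
    A e j = (j ∈S e) ∧ starPoint v j

    f-nonPlumeEdge : plumeEdgeAt v f ≡ false
    f-nonPlumeEdge with true-or-false (plumeEdgeAt v f)
    ... | inj₂ npe = npe
    ... | inj₁ pe with plumeEdgeAt⁻ pe
    ...   | x , pl , joins with joins-incident f-joins (joins⇒incidentʳ joins)
    ...     | inj₁ x≡v = ⊥-elim (joins⇒≢ joins (sym x≡v))
    ...     | inj₂ refl = ⊥-elim (true≢false pl w-nonPlume)

    selected⁻ : ∀ {e} → selected e ≡ true → plumeEdgeAt v e ≡ true ⊎ e ≡ f
    selected⁻ {e} s with ∨-true⁻ s
    ... | inj₁ pe   = inj₁ pe
    ... | inj₂ e≡f  = inj₂ (≟-true⁻ e≡f)

    selected⇒incident : ∀ {e} → selected e ≡ true → Incident G e v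
    selected⇒incident s with selected⁻ s
    ... | inj₁ pe   = plumeEdgeAt⇒incident pe
    ... | inj₂ refl = joins⇒incidentˡ f-joins

    one-plumeEdge : ∀ {i j} → selected i ≡ true → selected j ≡ true → i ≢ j →
                    plumeEdgeAt v i ≡ true ⊎ plumeEdgeAt v j ≡ true
    one-plumeEdge si sj i≢j with selected⁻ si | selected⁻ sj
    ... | inj₁ pi   | _         = inj₁ pi
    ... | inj₂ _    | inj₁ pj   = inj₂ pj
    ... | inj₂ refl | inj₂ refl = ⊥-elim (i≢j refl)

    meet-once : ∀ i j → selected i ≡ true → selected j ≡ true → i ≢ j →
                countF (λ x → A i x ∧ A j x) ≡ 1
    meet-once i j si sj i≢j =
      trans (countF-cong (λ x → ∧-restrict (x ∈S i) (x ∈S j) _ (common⇒starPoint x)))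
            (lineAdj⇒meet-once i≢j (v , selected⇒incident si , selected⇒incident sj))
      where
      common⇒starPoint : ∀ x → (x ∈S i) ∧ (x ∈S j) ≡ true → starPoint v x ≡ true
      common⇒starPoint x c with one-plumeEdge si sj i≢j
      ... | inj₁ pi = starPoint⁺ pi (proj₁ (∧-true⁻ c))
      ... | inj₂ pj = starPoint⁺ pj (proj₂ (∧-true⁻ c))

    plumeEdge-separates : ∀ {e e'} → plumeEdgeAt v e ≡ true → ¬ (S e ⊆ S e') →
                          ∃ λ x → A e x ≡ true × A e' x ≡ false
    plumeEdge-separates {e} {e'} pe S⊈ with ⊈⇒witness (S e) (S e') S⊈
    ... | x , x∈e , x∉e' = x , ∧-true⁺ x∈e (starPoint⁺ pe x∈e) , cong (_∧ starPoint v x) x∉e'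

    distinct : ∀ i j → selected i ≡ true → selected j ≡ true → i ≢ j →
               (∃ λ x → A i x ≡ true × A j x ≡ false) ⊎ (∃ λ x → A j x ≡ true × A i x ≡ false)
    distinct i j si sj i≢j with one-plumeEdge si sj i≢j
    ... | inj₁ pi = inj₁ (plumeEdge-separates pi (antichain i j i≢j))
    ... | inj₂ pj = inj₂ (plumeEdge-separates pj (antichain j i (i≢j ∘ sym)))

    selected-count : countF selected ≡ suc (countF (plumeEdgeAt v))
    selected-count =
      trans (countF-remove-true selected (∨-true⁺ʳ (plumeEdgeAt v f) (≟-true⁺ {i = f} refl)))
            (cong suc (countF-cong others))
      where
      others : ∀ e → (selected without f) e ≡ plumeEdgeAt v e
      others e with e ≟ f
      ... | yes refl = trans (∧-zeroʳ _) (sym f-nonPlumeEdge)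
      ... | no  _    = trans (∧-identityʳ _) (∨-identityʳ _)

    1≤plumesAt : 1 ≤ plumesAt G v
    1≤plumesAt with anyF⁻ _ (critical⇒hasPlume critical)
    ... | x , t = countF-pos⁺ (λ x → isPlume G x ∧ adjB G v x) x t

    open DeBruijnErdős selected A meet-once distinct

    covered⇒starPoint : ∀ x → covered x ≡ true → starPoint v x ≡ true
    covered⇒starPoint x c with anyF⁻ _ c
    ... | e , t = proj₂ (∧-true⁻ {x ∈S e} (proj₂ (∧-true⁻ {selected e} t)))

    starPoint-bound : suc (plumesAt G v) ≤ countF (starPoint v)
    starPoint-bound = begin
      suc (plumesAt G v)             ≤⟨ s≤s (plumesAt≤plumeEdges v) ⟩
      suc (countF (plumeEdgeAt v))   ≡⟨ sym selected-count ⟩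
      countF selected                ≤⟨ deBruijnErdős two ⟩
      countF covered                 ≤⟨ countF-mono covered⇒starPoint ⟩
      countF (starPoint v)           ∎
      where
      open ℕ.≤-Reasoning
      two : 2 ≤ countF selected
      two = subst (2 ≤_) (sym selected-count) (s≤s (≤-trans 1≤plumesAt (plumesAt≤plumeEdges v)))

  criticalStarPoint-count : Connected G → ¬ IsStar G → ∀ v →
                            (if isCritical G v then suc (plumesAt G v) else 0) ≤ countF (criticalStarPoint v)
  criticalStarPoint-count connected ¬star v with true-or-false (isCritical G v)
  ... | inj₂ nc rewrite nc = z≤n
  ... | inj₁ c  rewrite c with nonPlume-neighbour connected ¬star v
  ...   | w , f , joins , nonPlume = AtCriticalVertex.starPoint-bound v c w f joins nonPlume

  criticalSum≤numPc : Connected G → ¬ IsStar G →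
                      sumF (λ v → if isCritical G v then suc (plumesAt G v) else 0) ≤ countF (inPc G S)
  criticalSum≤numPc connected ¬star = begin
    sumF (λ v → if isCritical G v then suc (plumesAt G v) else 0)
      ≤⟨ sumF-mono-≤ (criticalStarPoint-count connected ¬star) ⟩
    sumF (λ v → countF (criticalStarPoint v))
      ≤⟨ sumF-countF-disjoint criticalStarPoint criticalStarPoint-unique ⟩
    countF (λ j → anyF (λ v → criticalStarPoint v j))
      ≤⟨ countF-mono (λ j t → criticalStarPoint⇒inPc (proj₂ (anyF⁻ (λ v → criticalStarPoint v j) t))) ⟩
    countF (inPc G S) ∎
    where open ℕ.≤-Reasoning

mainTheorem19 : (G : Graph) → Connected G → ¬ IsStar G →
                (p : ℕ) (S : Fin (Graph.m G) → Subset p) →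
                InFsa (LineAdj G) p S → p ≤ gamma' G →
                numPi G S ≤ numInland G
mainTheorem19 G connected ¬star p S (sar , _) p≤γ' =
  ℕ.+-cancelˡ-≤ criticalSum (numPi G S) (numInland G) (begin
    criticalSum + numPi G S       ≤⟨ ℕ.+-monoˡ-≤ (numPi G S) (criticalSum≤numPc connected ¬star) ⟩
    countF (inPc G S) + numPi G S ≡⟨ countF-complement (inPc G S) ⟩
    p                             ≤⟨ p≤γ' ⟩
    numInland G + criticalSum     ≡⟨ +-comm (numInland G) criticalSum ⟩
    criticalSum + numInland G     ∎)
  where
  open StarPoints G S sar
  open ℕ.≤-Reasoning
  criticalSum : ℕ
  criticalSum = sumF (λ v → if isCritical G v then suc (plumesAt G v) else 0)
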